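{- Let $G$ be a graph with maximum degree $\Delta = 3$. If $\mathrm{mad}(G) < \frac{36}{13}$, then $\chi_i(G) \leq 5$.
   Context: All graphs are finite and simple. For a graph $G$, $\mathrm{mad}(G)$ denotes the maximum average degree of $G$, i.e. the maximum of $2|E(H)|/|V(H)|$ over all nonempty subgraphs $H$ of $G$. An injective coloring of $G$ is an assignment of colors to the vertices of $G$ such that any two vertices having a common neighbor receive distinct colors. The injective chromatic number $\chi_i(G)$ is the minimum number of colors in an injective coloring of $G$. -}

module Defs where

open import Data.Nat using (ℕ; zero; suc; _+_; _*_; _<_)
open import Data.Bool using (Bool; true; false; _∧_)
open import Data.Fin using (Fin; toℕ)
open import Data.Fin.Subset using (Subset; _∈_; Nonempty; ∣_∣)
open import Data.List using (List; map; allFin)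
open import Data.Nat.ListAction using (sum)
open import Data.Nat using (_<ᵇ_)
open import Data.Product using (Σ; ∃; _×_)
open import Relation.Binary.PropositionalEquality using (_≡_; _≢_)

record Graph (n : ℕ) : Set where
  field
    adj     : Fin n → Fin n → Bool
    symm    : ∀ u v → adj u v ≡ adj v u
    irrefl  : ∀ v → adj v v ≡ false
open Graph public

boolToℕ : Bool → ℕ
boolToℕ true  = 1
boolToℕ false = 0

countTrue : {n : ℕ} → (Fin n → Bool) → ℕ
countTrue {n} f = sum (map (λ v → boolToℕ (f v)) (allFin n))

degree : {n : ℕ} → Graph n → Fin n → ℕ
degree G u = countTrue (adj G u)

MaxDegreeIs : {n : ℕ} → Graph n → ℕ → Set
MaxDegreeIs {n} G d = (∀ v → degree G v Data.Nat.≤ d) × ∃ λ v → degree G v ≡ d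

record Subgraph {n : ℕ} (G : Graph n) : Set where
  field
    verts   : Subset n
    edges   : Fin n → Fin n → Bool
    esymm   : ∀ u v → edges u v ≡ edges v u
    eInG    : ∀ u v → edges u v ≡ true → adj G u v ≡ true
    eInVerts : ∀ u v → edges u v ≡ true → (u ∈ verts × v ∈ verts)
open Subgraph public

edgeCount : {n : ℕ} {G : Graph n} → Subgraph G → ℕ
edgeCount {n} H =
  sum (map (λ u → countTrue (λ v → (toℕ u <ᵇ toℕ v) ∧ edges H u v)) (allFin n))

-- mad(G) < p / q  (q > 0): every nonempty subgraph H satisfies
-- 2|E(H)| / |V(H)| < p / q, i.e. q * 2|E(H)| < p * |V(H)|
MadLessThan : {n : ℕ} → Graph n → ℕ → ℕ → Set
MadLessThan G p q =
  (H : Subgraph G) → Nonempty (verts H) → q * (2 * edgeCount H) < p * ∣ verts H ∣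

IsInjectiveColoring : {n k : ℕ} → Graph n → (Fin n → Fin k) → Set
IsInjectiveColoring G c =
  ∀ u v w → u ≢ v → adj G u w ≡ true → adj G v w ≡ true → c u ≢ c v

InjChromaticAtMost : {n : ℕ} → Graph n → ℕ → Set
InjChromaticAtMost G k = Σ (_ → Fin k) λ c → IsInjectiveColoring G c

module Submission where

-- Vertex sets are Boolean predicates S on Fin n, and G[S] is the induced subgraph.
-- Two vertices are in conflict in G[S] if they are distinct and have a common
-- neighbour in S; an injective colouring of G[S] is a colouring of S proper for this
-- conflict relation. Every G[S] has one with five colours, by induction on |S|.
--
-- Inside G[S], a vertex p has at most 2·deg(p) conflicts,
-- fewer when some neighbours of p have few other neighbours. This makes four local
-- configurations reducible: a colouring of G[S ∖ v] for a suitable 2-vertex v (or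
-- vertex of degree ≤ 1) can be repaired and extended to G[S]. A discharging argument
-- shows that a G[S] without these configurations satisfies 36·|S| ≤ 13·∑ deg, which,
-- through the handshake lemma, contradicts mad(G) < 36/13. The theorem is the case
-- where S is the whole vertex set.

open import Data.Nat using (ℕ; zero; suc; _+_; _*_; _≤_; _<_; z≤n; s≤s; _<ᵇ_; _≤?_)
open import Data.Nat.Properties hiding (_≟_)
open import Data.Nat.Properties using () renaming (_≟_ to _≟ℕ_)
open import Data.Nat.ListAction using () renaming (sum to listSum)
open import Data.Bool using (Bool; true; false; _∧_; not; if_then_else_)
open import Data.Bool.Properties using (∧-zeroʳ; ∧-identityʳ; ¬-not) renaming (_≟_ to _≟ᵇ_)
open import Data.Fin using (Fin; zero; suc; toℕ)
open import Data.Fin.Properties using (_≟_; any?; all?; toℕ-injective) renaming (suc-injective to suc-injectiveᶠ)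
open import Data.Fin.Subset using (∣_∣; _∈_)
open import Data.Vec using (tabulate)
open import Data.Vec.Properties using (lookup∘tabulate; lookup⇒[]=)
open import Data.List as List using ()
open import Data.Product using (∃; _×_; _,_; proj₁; proj₂)
open import Data.Sum using (_⊎_; inj₁; inj₂)
open import Data.Empty using (⊥; ⊥-elim)
open import Function using (_∘_; id)
open import Function.Bundles using (mk⇔)
open import Relation.Nullary using (¬_; Dec; yes; no; does; contradiction)
open import Relation.Nullary.Decidable using (dec-true; dec-false; does-⇔; _×-dec_; _→-dec_; ¬?)
open import Relation.Nullary.Reflects using (ofʸ; ofⁿ)
open import Relation.Binary.PropositionalEquality
open import Algebra.Properties.Semiring.Sum +-*-semiring
  using (sum; sum-syntax; sum-cong-≗; sum-replicate-zero; ∑-distrib-+; ∑-comm; *-distribˡ-sum)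
open import Algebra.Properties.CommutativeSemigroup +-commutativeSemigroup using (x∙yz≈y∙xz)
open import Defs

∧-elim : ∀ a {b} → a ∧ b ≡ true → a ≡ true × b ≡ true
∧-elim true {true} refl = refl , refl

true≢false : true ≢ false
true≢false ()

∧-intro : ∀ {a b} → a ≡ true → b ≡ true → a ∧ b ≡ true
∧-intro refl refl = refl

fromDoes : ∀ {P : Set} (P? : Dec P) → does P? ≡ true → P
fromDoes (yes p) _ = p

fromDoesNot : ∀ {P : Set} (P? : Dec P) → not (does P?) ≡ true → ¬ P
fromDoesNot (no ¬p) _ = ¬p

∑-mono : ∀ {n} {f g : Fin n → ℕ} → (∀ i → f i ≤ g i) → sum f ≤ sum g
∑-mono {zero}  h = z≤n
∑-mono {suc n} h = +-mono-≤ (h zero) (∑-mono (h ∘ suc))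

∑-term : ∀ {n} (f : Fin n → ℕ) (i : Fin n) → f i ≤ sum f
∑-term f zero    = m≤m+n _ _
∑-term f (suc i) = ≤-trans (∑-term (f ∘ suc) i) (m≤n+m _ (f zero))

count : ∀ {n} → (Fin n → Bool) → ℕ
count {n} P = ∑[ u < n ] boolToℕ (P u)

_⊆_ : ∀ {n} → (Fin n → Bool) → (Fin n → Bool) → Set
P ⊆ Q = ∀ u → P u ≡ true → Q u ≡ true

⊆-refl : ∀ {n} {P : Fin n → Bool} → P ⊆ P
⊆-refl _ p = p

sum-map-tabulate : ∀ {n} {A : Set} (f : A → ℕ) (g : Fin n → A) →
                   listSum (List.map f (List.tabulate g)) ≡ ∑[ i < n ] f (g i)
sum-map-tabulate {zero}  f g = refl
sum-map-tabulate {suc n} f g = cong (f (g zero) +_) (sum-map-tabulate f (g ∘ suc))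

countTrue≡count : ∀ {n} (P : Fin n → Bool) → countTrue P ≡ count P
countTrue≡count P = sum-map-tabulate (boolToℕ ∘ P) id

count-mono : ∀ {n} {P Q : Fin n → Bool} → P ⊆ Q → count P ≤ count Q
count-mono {P = P} {Q} h = ∑-mono pointwise
  where
  pointwise : ∀ u → boolToℕ (P u) ≤ boolToℕ (Q u)
  pointwise u with P u in pu
  ... | false = z≤n
  ... | true  rewrite h u pu = ≤-refl

count-empty : ∀ {n} {P : Fin n → Bool} → (∀ u → P u ≡ false) → count P ≡ 0
count-empty {n} h = trans (sum-cong-≗ (cong boolToℕ ∘ h)) (sum-replicate-zero n)

count-pos : ∀ {n} (P : Fin n → Bool) {a} → P a ≡ true → 1 ≤ count P
count-pos P {a} pa = subst (λ b → boolToℕ b ≤ count P) pa (∑-term (boolToℕ ∘ P) a)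

_∖_ : ∀ {n} → (Fin n → Bool) → Fin n → (Fin n → Bool)
(P ∖ a) u = P u ∧ not (does (u ≟ a))

count-remove : ∀ {n} (P : Fin n → Bool) (a : Fin n) → count P ≡ boolToℕ (P a) + count (P ∖ a)
count-remove P zero =
  cong (boolToℕ (P zero) +_)
       (cong₂ _+_ (cong boolToℕ (sym (∧-zeroʳ (P zero))))
                  (sum-cong-≗ λ i → cong boolToℕ (sym (∧-identityʳ (P (suc i))))))
count-remove P (suc a) = begin
  boolToℕ (P zero) + count (P ∘ suc)
    ≡⟨ cong (boolToℕ (P zero) +_) (count-remove (P ∘ suc) a) ⟩
  boolToℕ (P zero) + (boolToℕ (P (suc a)) + count ((P ∘ suc) ∖ a))
    ≡⟨ x∙yz≈y∙xz (boolToℕ (P zero)) (boolToℕ (P (suc a))) (count ((P ∘ suc) ∖ a)) ⟩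
  boolToℕ (P (suc a)) + (boolToℕ (P zero) + count ((P ∘ suc) ∖ a))
    ≡⟨ cong (λ b → boolToℕ (P (suc a)) + (boolToℕ b + count ((P ∘ suc) ∖ a))) (sym (∧-identityʳ (P zero))) ⟩
  boolToℕ (P (suc a)) + count (P ∖ suc a)
    ∎
  where open ≡-Reasoning

count-< : ∀ {n} (P Q : Fin n → Bool) {a : Fin n} → P a ≡ true → Q ⊆ (P ∖ a) → suc (count Q) ≤ count P
count-< P Q {a} pa Q⊆P∖a = begin
  suc (count Q)               ≤⟨ s≤s (count-mono Q⊆P∖a) ⟩
  suc (count (P ∖ a))         ≡⟨ cong (λ b → boolToℕ b + count (P ∖ a)) (sym pa) ⟩
  boolToℕ (P a) + count (P ∖ a) ≡⟨ sym (count-remove P a) ⟩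
  count P                     ∎
  where open ≤-Reasoning

removed : ∀ {n} {P : Fin n → Bool} {a u} → P u ≡ true → u ≢ a → (P ∖ a) u ≡ true
removed {a = a} {u = u} pu u≢a rewrite dec-false (u ≟ a) u≢a = ∧-intro pu refl

count-≥2 : ∀ {n} (P : Fin n → Bool) {a b} → P a ≡ true → P b ≡ true → a ≢ b → 2 ≤ count P
count-≥2 P {a} {b} pa pb a≢b =
  ≤-trans (s≤s (count-pos (P ∖ a) (removed {P = P} pb (a≢b ∘ sym)))) (count-< P (P ∖ a) pa ⊆-refl)

count-≥3 : ∀ {n} (P : Fin n → Bool) {a b c} → P a ≡ true → P b ≡ true → P c ≡ true →
           a ≢ b → a ≢ c → b ≢ c → 3 ≤ count P
count-≥3 P {a} pa pb pc a≢b a≢c b≢c =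
  ≤-trans (s≤s (count-≥2 (P ∖ a) (removed {P = P} pb (a≢b ∘ sym)) (removed {P = P} pc (a≢c ∘ sym)) b≢c))
          (count-< P (P ∖ a) pa ⊆-refl)

count≤1 : ∀ {n} (P : Fin n → Bool) → (∀ a b → P a ≡ true → P b ≡ true → a ≡ b) → count P ≤ 1
count≤1 {zero}  P unique = z≤n
count≤1 {suc n} P unique with P zero in p0
... | true  = ≤-reflexive (cong suc (count-empty only-zero))
  where
  only-zero : ∀ i → P (suc i) ≡ false
  only-zero i with P (suc i) in pi
  ... | false = refl
  ... | true  with () ← unique zero (suc i) p0 pi
... | false = count≤1 (P ∘ suc) (λ a b pa pb → suc-injectiveᶠ (unique (suc a) (suc b) pa pb))

⟦_⟧ : ∀ {P : Set} → Dec P → ℕ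
⟦ P? ⟧ = boolToℕ (does P?)

⟦⟧-yes : ∀ {P : Set} (P? : Dec P) → P → ⟦ P? ⟧ ≡ 1
⟦⟧-yes P? p rewrite dec-true P? p = refl

⟦⟧-no : ∀ {P : Set} (P? : Dec P) → ¬ P → ⟦ P? ⟧ ≡ 0
⟦⟧-no P? ¬p rewrite dec-false P? ¬p = refl

count≤indicator : ∀ {n} (P : Fin n → Bool) {b} → (∀ a → P a ≡ true → b ≡ true) →
                  (∀ a a′ → P a ≡ true → P a′ ≡ true → a ≡ a′) → count P ≤ boolToℕ b
count≤indicator P {true}  _     unique = count≤1 P unique
count≤indicator P {false} only-if _    = ≤-reflexive (count-empty empty)
  where
  empty : ∀ a → P a ≡ false
  empty a with P a in pa
  ... | false = refl
  ... | true  = sym (only-if a pa)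

count-singleton : ∀ {m} (x : Fin m) → count (λ k → does (x ≟ k)) ≡ 1
count-singleton {suc m} zero = cong suc (count-empty {m} (λ k → refl))
count-singleton {suc m} (suc x) = count-singleton x

colourClass : ∀ {n} → (Fin n → Bool) → (Fin n → Fin 5) → Fin 5 → Fin n → Bool
colourClass Q c k u = Q u ∧ does (c u ≟ k)

colourClasses : ∀ {n} (Q : Fin n → Bool) (c : Fin n → Fin 5) →
                ∑[ k < 5 ] count (colourClass Q c k) ≡ count Q
colourClasses Q c = trans (∑-comm (λ k u → boolToℕ (colourClass Q c k u))) (sum-cong-≗ onePerVertex)
  where
  onePerVertex : ∀ u → ∑[ k < 5 ] boolToℕ (colourClass Q c k u) ≡ boolToℕ (Q u)
  onePerVertex u with Q u
  ... | true  = count-singleton (c u)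
  ... | false = count-empty {5} (λ _ → refl)

-- if all five classes were nonempty, Q would have at least five elements
missingColour : ∀ {n} (Q : Fin n → Bool) (c : Fin n → Fin 5) → count Q ≤ 4 →
                ∃ λ k → ∀ u → Q u ≡ true → c u ≢ k
missingColour Q c Q≤4 with any? (λ k → count (colourClass Q c k) ≟ℕ 0)
... | yes (k , empty) = k , λ u qu cu≡k →
  contradiction (subst (1 ≤_) empty (count-pos (colourClass Q c k) (∧-intro qu (dec-true (c u ≟ k) cu≡k)))) λ ()
... | no allUsed = contradiction Q≤4 (<⇒≱ (subst (5 ≤_) (colourClasses Q c) (∑-mono classNonempty)))
  where
  classNonempty : ∀ k → 1 ≤ count (colourClass Q c k)
  classNonempty k = n≢0⇒n>0 (λ empty → allUsed (k , empty))

-- Proper colourings for an abstract conflict relation C, and greedy recolouring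

Colouring : ℕ → Set
Colouring n = Fin n → Fin 5

ProperOn : ∀ {n} → (Fin n → Fin n → Bool) → (Fin n → Bool) → Colouring n → Set
ProperOn C D c = ∀ u v → D u ≡ true → D v ≡ true → C u v ≡ true → c u ≢ c v

properOn-mono : ∀ {n C} {D D′ : Fin n → Bool} {c} → D′ ⊆ D → ProperOn C D c → ProperOn C D′ c
properOn-mono D′⊆D proper u v du dv = proper u v (D′⊆D u du) (D′⊆D v dv)

∖-⊆ : ∀ {n} {P : Fin n → Bool} {a u} → (P ∖ a) u ≡ true → P u ≡ true
∖-⊆ {P = P} {u = u} = proj₁ ∘ ∧-elim (P u)

∖-≢ : ∀ {n} {P : Fin n → Bool} {a u} → (P ∖ a) u ≡ true → u ≢ a
∖-≢ {P = P} {a} {u} = fromDoesNot (u ≟ a) ∘ proj₂ ∘ ∧-elim (P u)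

∖-self : ∀ {n} (P : Fin n → Bool) a → (P ∖ a) a ≡ false
∖-self P a rewrite dec-true (a ≟ a) refl = ∧-zeroʳ (P a)

∖-∖-⊆ : ∀ {n} {P : Fin n → Bool} {a b u} → ((P ∖ a) ∖ b) u ≡ true → (P ∖ b) u ≡ true
∖-∖-⊆ {P = P} {a} {u = u} p with ∧-elim ((P ∖ a) u) p
... | pa , u≢b = ∧-intro (∖-⊆ {P = P} pa) u≢b

_[_↦_] : ∀ {n} → Colouring n → Fin n → Fin 5 → Colouring n
(c [ x ↦ k ]) u = if does (u ≟ x) then k else c u

conflicts : ∀ {n} → (Fin n → Fin n → Bool) → (Fin n → Bool) → Fin n → Fin n → Bool
conflicts C D x u = D u ∧ C x u

Recolourable : ∀ {n} → (Fin n → Fin n → Bool) → (Fin n → Bool) → Fin n → Set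
Recolourable C D x =
  count (conflicts C D x) ≤ 4 ⊎
  (count (conflicts C D x) ≤ 5 × ∃ λ p → conflicts C D x p ≡ true × count (conflicts C D p) ≤ 4)

module Recolouring {n} (C : Fin n → Fin n → Bool)
                   (C-sym : ∀ u v → C u v ≡ C v u) (C-irrefl : ∀ u → C u u ≡ false) where

  extend : ∀ {D c x k} → ProperOn C (D ∖ x) c → (∀ u → conflicts C D x u ≡ true → c u ≢ k) →
           ProperOn C D (c [ x ↦ k ])
  extend {D} {x = x} proper fresh u v du dv cuv with u ≟ x | v ≟ x
  ... | yes refl | yes refl = contradiction (trans (sym cuv) (C-irrefl x)) λ ()
  ... | yes refl | no v≢x   = λ k≡cv → fresh v (∧-intro dv cuv) (sym k≡cv)
  ... | no u≢x   | yes refl = fresh u (∧-intro du (trans (C-sym x u) cuv))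
  ... | no u≢x   | no v≢x   = proper u v (removed {P = D} du u≢x) (removed {P = D} dv v≢x) cuv

  greedy : ∀ {D c x} → ProperOn C (D ∖ x) c → count (conflicts C D x) ≤ 4 → ∃ (ProperOn C D)
  greedy {D} {c} {x} proper few with missingColour (conflicts C D x) c few
  ... | k , fresh = c [ x ↦ k ] , extend proper fresh

  -- if x has at most five conflicts, one of which, p, has at most four, first colour x
  -- avoiding its conflicts other than p, then recolour p greedily
  greedy₂ : ∀ {D c x p} → ProperOn C (D ∖ x) c → count (conflicts C D x) ≤ 5 →
            conflicts C D x p ≡ true → count (conflicts C D p) ≤ 4 → ∃ (ProperOn C D)
  greedy₂ {D} {c} {x} {p} proper x≤5 xp p≤4 with missingColour (conflicts C (D ∖ p) x) c fewer
    where
    fewer : count (conflicts C (D ∖ p) x) ≤ 4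
    fewer = ≤-pred (≤-trans (count-< (conflicts C D x) (conflicts C (D ∖ p) x) xp other) x≤5)
      where
      other : ∀ u → conflicts C (D ∖ p) x u ≡ true → (conflicts C D x ∖ p) u ≡ true
      other u up with ∧-elim ((D ∖ p) u) up
      ... | d∖p , cxu with ∧-elim (D u) d∖p
      ... | du , u≢p = ∧-intro (∧-intro du cxu) u≢p
  ... | k , fresh = greedy {D} {c [ x ↦ k ]} {p} (extend (properOn-mono (λ u → ∖-∖-⊆ {P = D}) proper) fresh) p≤4

  recolour : ∀ {D c x} → ProperOn C (D ∖ x) c → Recolourable C D x → ∃ (ProperOn C D)
  recolour proper (inj₁ few)                   = greedy proper few
  recolour proper (inj₂ (x≤5 , p , xp , p≤4)) = greedy₂ proper x≤5 xp p≤4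

two-or-three : ∀ {d} → 2 ≤ d → d ≤ 3 → d ≡ 2 ⊎ d ≡ 3
two-or-three {2} _ _ = inj₁ refl
two-or-three {3} _ _ = inj₂ refl
two-or-three {1} (s≤s ()) _
two-or-three {suc (suc (suc (suc _)))} _ (s≤s (s≤s (s≤s ())))

order-split : ∀ {n} {u w : Fin n} → u ≢ w → boolToℕ (toℕ u <ᵇ toℕ w) + boolToℕ (toℕ w <ᵇ toℕ u) ≡ 1
order-split {u = u} {w} u≢w
  with toℕ u <ᵇ toℕ w | <ᵇ-reflects-< (toℕ u) (toℕ w) | toℕ w <ᵇ toℕ u | <ᵇ-reflects-< (toℕ w) (toℕ u)
... | true  | ofʸ u<w | true  | ofʸ w<u = contradiction w<u (<-asym u<w)
... | true  | _       | false | _       = refl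
... | false | _       | true  | _       = refl
... | false | ofⁿ u≮w | false | ofⁿ w≮u = contradiction (toℕ-injective (≤-antisym (≮⇒≥ w≮u) (≮⇒≥ u≮w))) u≢w

handshake : ∀ {n} (e : Fin n → Fin n → Bool) → (∀ u w → e u w ≡ e w u) → (∀ u → e u u ≡ false) →
            2 * ∑[ u < n ] count (λ w → (toℕ u <ᵇ toℕ w) ∧ e u w) ≡ ∑[ u < n ] count (e u)
handshake {n} e e-sym e-irrefl = begin
  2 * upward                                 ≡⟨ cong (upward +_) (+-identityʳ upward) ⟩
  upward + upward                            ≡⟨ cong (upward +_) mirror ⟩
  upward + downward                          ≡⟨ sym (∑-distrib-+ (λ u → count (before u)) (λ u → count (after u))) ⟩
  ∑[ u < n ] (count (before u) + count (after u))
    ≡⟨ sum-cong-≗ (λ u → sym (∑-distrib-+ (boolToℕ ∘ before u) (boolToℕ ∘ after u))) ⟩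
  ∑[ u < n ] ∑[ w < n ] (boolToℕ (before u w) + boolToℕ (after u w))
    ≡⟨ sum-cong-≗ (λ u → sum-cong-≗ (split u)) ⟩
  ∑[ u < n ] count (e u)                     ∎
  where
  open ≡-Reasoning
  before after : Fin n → Fin n → Bool
  before u w = (toℕ u <ᵇ toℕ w) ∧ e u w
  after  u w = (toℕ w <ᵇ toℕ u) ∧ e u w
  upward downward : ℕ
  upward   = ∑[ u < n ] count (before u)
  downward = ∑[ u < n ] count (after u)
  mirror : upward ≡ downward
  mirror = trans (∑-comm (λ u w → boolToℕ (before u w)))
                 (sum-cong-≗ λ w → sum-cong-≗ λ u → cong (λ b → boolToℕ ((toℕ u <ᵇ toℕ w) ∧ b)) (e-sym u w))
  split : ∀ u w → boolToℕ (before u w) + boolToℕ (after u w) ≡ boolToℕ (e u w)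
  split u w with e u w in related
  ... | false = cong₂ (λ a b → boolToℕ a + boolToℕ b) (∧-zeroʳ (toℕ u <ᵇ toℕ w)) (∧-zeroʳ (toℕ w <ᵇ toℕ u))
  ... | true  = trans (cong₂ (λ a b → boolToℕ a + boolToℕ b)
                             (∧-identityʳ (toℕ u <ᵇ toℕ w)) (∧-identityʳ (toℕ w <ᵇ toℕ u)))
                      (order-split {u = u} {w} λ { refl → true≢false (trans (sym related) (e-irrefl u)) })

tabulate-size : ∀ {n} (S : Fin n → Bool) → ∣ tabulate S ∣ ≡ count S
tabulate-size {zero}  S = refl
tabulate-size {suc n} S with S zero
... | true  = cong suc (tabulate-size (S ∘ suc))
... | false = tabulate-size (S ∘ suc)

module InducedSubgraphs {n} (G : Graph n) (Δ≤3 : ∀ v → degree G v ≤ 3) where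

  A : Fin n → Fin n → Bool
  A = adj G

  nbr : (Fin n → Bool) → Fin n → Fin n → Bool
  nbr S v u = A v u ∧ S u

  deg : (Fin n → Bool) → Fin n → ℕ
  deg S v = count (nbr S v)

  deg≤3 : ∀ S v → deg S v ≤ 3
  deg≤3 S v = ≤-trans (count-mono (λ u → proj₁ ∘ ∧-elim (A v u)))
                      (subst (_≤ 3) (countTrue≡count (A v)) (Δ≤3 v))

  nbr-adj : ∀ S {u v} → nbr S u v ≡ true → A u v ≡ true
  nbr-adj S {u} {v} = proj₁ ∘ ∧-elim (A u v)

  nbr-∈ : ∀ S {u v} → nbr S u v ≡ true → S v ≡ true
  nbr-∈ S {u} {v} = proj₂ ∘ ∧-elim (A u v)

  adj-≢ : ∀ {u v} → A u v ≡ true → u ≢ v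
  adj-≢ {u} uv refl = true≢false (trans (sym uv) (irrefl G u))

  nbr-flip : ∀ S {u v} → S u ≡ true → nbr S u v ≡ true → nbr S v u ≡ true
  nbr-flip S {u} {v} su uv = ∧-intro (trans (symm G v u) (proj₁ (∧-elim (A u v) uv))) su

  CommonNeighbour : (Fin n → Bool) → Fin n → Fin n → Set
  CommonNeighbour S u v = ∃ λ w → S w ≡ true × A u w ≡ true × A v w ≡ true

  commonNeighbour? : ∀ S u v → Dec (CommonNeighbour S u v)
  commonNeighbour? S u v = any? λ w → (S w ≟ᵇ true) ×-dec (A u w ≟ᵇ true) ×-dec (A v w ≟ᵇ true)

  conflict : (Fin n → Bool) → Fin n → Fin n → Bool
  conflict S u v = not (does (u ≟ v)) ∧ does (commonNeighbour? S u v)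

  conflict-intro : ∀ {S u v} w → u ≢ v → S w ≡ true → A u w ≡ true → A v w ≡ true →
                   conflict S u v ≡ true
  conflict-intro {S} {u} {v} w u≢v sw auw avw =
    ∧-intro (cong not (dec-false (u ≟ v) u≢v)) (dec-true (commonNeighbour? S u v) (w , sw , auw , avw))

  conflict-elim : ∀ {S u v} → conflict S u v ≡ true → u ≢ v × CommonNeighbour S u v
  conflict-elim {S} {u} {v} p with ∧-elim (not (does (u ≟ v))) p
  ... | distinct , common = fromDoesNot (u ≟ v) distinct , fromDoes (commonNeighbour? S u v) common

  conflict-sym : ∀ S u v → conflict S u v ≡ conflict S v u
  conflict-sym S u v = cong₂ _∧_ (cong not (does-⇔ (mk⇔ sym sym) (u ≟ v) (v ≟ u)))
                                 (does-⇔ (mk⇔ swap swap) (commonNeighbour? S u v) (commonNeighbour? S v u))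
    where
    swap : ∀ {a b} → CommonNeighbour S a b → CommonNeighbour S b a
    swap (w , sw , aw , bw) = w , sw , bw , aw

  conflict-irrefl : ∀ S u → conflict S u u ≡ false
  conflict-irrefl S u rewrite dec-true (u ≟ u) refl = refl

  conflict-remove : ∀ {S} v {a b} → conflict S a b ≡ true →
                    conflict (S ∖ v) a b ≡ true ⊎ (a ≢ b × A a v ≡ true × A b v ≡ true)
  conflict-remove {S} v p with conflict-elim p
  ... | a≢b , w , sw , aw , bw with w ≟ v
  ... | yes refl = inj₂ (a≢b , aw , bw)
  ... | no w≢v   = inj₁ (conflict-intro w a≢b (removed {P = S} sw w≢v) aw bw)

  lift : ∀ {S v D c} → D ⊆ (S ∖ v) → ProperOn (conflict (S ∖ v)) (S ∖ v) c →
         (∀ a b → D a ≡ true → D b ≡ true → a ≢ b → A a v ≡ true → A b v ≡ true → ⊥) →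
         ProperOn (conflict S) D c
  lift {v = v} D⊆ proper apart a b da db ab with conflict-remove v ab
  ... | inj₁ ab′                = proper a b (D⊆ a da) (D⊆ b db) ab′
  ... | inj₂ (a≢b , av , bv)   = ⊥-elim (apart a b da db a≢b av bv)

  reach : (Fin n → Bool) → Fin n → Fin n → ℕ
  reach D t p = count (nbr D t ∖ p)

  -- every conflict of p in D is reached from p through a neighbour of p
  conflicts-via-nbrs : ∀ S D p →
    count (conflicts (conflict S) D p) ≤ ∑[ t < n ] (boolToℕ (nbr S p t) * reach D t p)
  conflicts-via-nbrs S D p = begin
    count (conflicts (conflict S) D p)              ≤⟨ ∑-mono reached ⟩
    ∑[ u < n ] ∑[ t < n ] path t u                  ≡⟨ ∑-comm (λ u t → path t u) ⟩
    ∑[ t < n ] ∑[ u < n ] path t u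
      ≡⟨ sum-cong-≗ (λ t → sym (*-distribˡ-sum {n} (boolToℕ (nbr S p t)) (boolToℕ ∘ (nbr D t ∖ p)))) ⟩
    ∑[ t < n ] (boolToℕ (nbr S p t) * reach D t p)    ∎
    where
    open ≤-Reasoning
    path : Fin n → Fin n → ℕ
    path t u = boolToℕ (nbr S p t) * boolToℕ ((nbr D t ∖ p) u)
    reached : ∀ u → boolToℕ (conflicts (conflict S) D p u) ≤ ∑[ t < n ] path t u
    reached u with conflicts (conflict S) D p u in in-conflict
    ... | false = z≤n
    ... | true with ∧-elim (D u) in-conflict
    ... | du , pu with conflict-elim pu
    ... | p≢u , w , sw , apw , auw = subst (_≤ ∑[ t < n ] path t u) through-w (∑-term (λ t → path t u) w)
      where
      through-w : path w u ≡ 1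
      through-w rewrite apw | sw | trans (symm G w u) auw | du | dec-false (u ≟ p) (p≢u ∘ sym) = refl

  reach-bound : ∀ {S D t p} → D ⊆ S → nbr S t p ≡ true → suc (reach D t p) ≤ deg S t
  reach-bound {S} {D} {t} {p} D⊆S tp = count-< (nbr S t) (nbr D t ∖ p) tp inside
    where
    inside : (nbr D t ∖ p) ⊆ (nbr S t ∖ p)
    inside u q with ∧-elim (nbr D t u) q
    ... | tu , u≢p with ∧-elim (A t u) tu
    ... | atu , du = ∧-intro (∧-intro atu (D⊆S u du)) u≢p

  reach-bound₂ : ∀ {S D t p q} → D ⊆ S → nbr S t p ≡ true → nbr S t q ≡ true → q ≢ p → D q ≡ false →
                 suc (suc (reach D t p)) ≤ deg S t
  reach-bound₂ {S} {D} {t} {p} {q} D⊆S tp tq q≢p dq =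
    ≤-trans (s≤s (count-< (nbr S t ∖ p) (nbr D t ∖ p) (removed {P = nbr S t} tq q≢p) inside))
            (count-< (nbr S t) (nbr S t ∖ p) tp ⊆-refl)
    where
    inside : (nbr D t ∖ p) ⊆ ((nbr S t ∖ p) ∖ q)
    inside u r with ∧-elim (nbr D t u) r
    ... | tu , u≢p with ∧-elim (A t u) tu
    ... | atu , du = removed {P = nbr S t ∖ p} (∧-intro (∧-intro atu (D⊆S u du)) u≢p)
                             (λ u≡q → true≢false (trans (sym du) (trans (cong D u≡q) dq)))

  light : (S D : Fin n → Bool) → Fin n → Fin n → Bool
  light S D p t = nbr S p t ∧ does (reach D t p ≤? 1)

  light-intro : ∀ {S D p t} → nbr S p t ≡ true → reach D t p ≤ 1 → light S D p t ≡ true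
  light-intro {D = D} {p} {t} pt r≤1 = ∧-intro pt (dec-true (reach D t p ≤? 1) r≤1)

  conflict-degree : ∀ {S D p} → D ⊆ S → S p ≡ true →
    count (conflicts (conflict S) D p) + count (light S D p) ≤ 2 * deg S p
  conflict-degree {S} {D} {p} D⊆S sp = begin
    count (conflicts (conflict S) D p) + count (light S D p)
      ≤⟨ +-monoˡ-≤ (count (light S D p)) (conflicts-via-nbrs S D p) ⟩
    ∑[ t < n ] (boolToℕ (nbr S p t) * reach D t p) + count (light S D p)
      ≡⟨ sym (∑-distrib-+ (λ t → boolToℕ (nbr S p t) * reach D t p) (boolToℕ ∘ light S D p)) ⟩
    ∑[ t < n ] (boolToℕ (nbr S p t) * reach D t p + boolToℕ (light S D p t))
      ≤⟨ ∑-mono perNeighbour ⟩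
    ∑[ t < n ] (2 * boolToℕ (nbr S p t))
      ≡⟨ sym (*-distribˡ-sum {n} 2 (boolToℕ ∘ nbr S p)) ⟩
    2 * deg S p ∎
    where
    open ≤-Reasoning
    lightness : ∀ r → r ≤ 2 → 1 * r + boolToℕ (does (r ≤? 1)) ≤ 2
    lightness 0 _ = s≤s z≤n
    lightness 1 _ = ≤-refl
    lightness 2 _ = ≤-refl
    lightness (suc (suc (suc r))) (s≤s (s≤s ()))
    perNeighbour : ∀ t → boolToℕ (nbr S p t) * reach D t p + boolToℕ (light S D p t) ≤ 2 * boolToℕ (nbr S p t)
    perNeighbour t with nbr S p t in pt
    ... | false = z≤n
    ... | true  = lightness (reach D t p)
                    (≤-pred (≤-trans (reach-bound D⊆S (nbr-flip S sp pt)) (deg≤3 S t)))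

  -- the three consequences used by the reductions (a 3-vertex p has 6 = 2·3)
  conflicts-≤2deg : ∀ {S D p} → D ⊆ S → S p ≡ true → count (conflicts (conflict S) D p) ≤ 2 * deg S p
  conflicts-≤2deg D⊆S sp = m+n≤o⇒m≤o _ (conflict-degree D⊆S sp)

  conflicts-one-light : ∀ {S D p t} → D ⊆ S → S p ≡ true → light S D p t ≡ true →
                        count (conflicts (conflict S) D p) ≤ 5
  conflicts-one-light {S} {D} {p} D⊆S sp lt = +-cancelʳ-≤ 1 _ 5 (begin
    count (conflicts (conflict S) D p) + 1  ≤⟨ +-monoʳ-≤ _ (count-pos (light S D p) lt) ⟩
    count (conflicts (conflict S) D p) + count (light S D p) ≤⟨ conflict-degree D⊆S sp ⟩
    2 * deg S p                               ≤⟨ *-monoʳ-≤ 2 (deg≤3 S p) ⟩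
    6 ∎)
    where open ≤-Reasoning

  conflicts-two-light : ∀ {S D p t₁ t₂} → D ⊆ S → S p ≡ true →
                        light S D p t₁ ≡ true → light S D p t₂ ≡ true → t₁ ≢ t₂ →
                        count (conflicts (conflict S) D p) ≤ 4
  conflicts-two-light {S} {D} {p} D⊆S sp l₁ l₂ t₁≢t₂ = +-cancelʳ-≤ 2 _ 4 (begin
    count (conflicts (conflict S) D p) + 2  ≤⟨ +-monoʳ-≤ _ (count-≥2 (light S D p) l₁ l₂ t₁≢t₂) ⟩
    count (conflicts (conflict S) D p) + count (light S D p) ≤⟨ conflict-degree D⊆S sp ⟩
    2 * deg S p                               ≤⟨ *-monoʳ-≤ 2 (deg≤3 S p) ⟩
    6 ∎)
    where open ≤-Reasoning

  Colourable : (Fin n → Bool) → Set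
  Colourable S = ∃ (ProperOn (conflict S) S)

  IsTwo IsThree : (Fin n → Bool) → Fin n → Set
  IsTwo   S v = S v ≡ true × deg S v ≡ 2
  IsThree S v = S v ≡ true × deg S v ≡ 3

  isTwo? : ∀ S v → Dec (IsTwo S v)
  isTwo? S v = (S v ≟ᵇ true) ×-dec (deg S v ≟ℕ 2)

  isThree? : ∀ S v → Dec (IsThree S v)
  isThree? S v = (S v ≟ᵇ true) ×-dec (deg S v ≟ℕ 3)

  Config₁ : (Fin n → Bool) → Set
  Config₁ S = ∃ λ u → S u ≡ true × deg S u ≤ 1
  Config₂ : (Fin n → Bool) → Set
  Config₂ S = ∃ λ v → ∃ λ z → IsTwo S v × nbr S v z ≡ true × deg S z ≤ 2
  Config₃ : (Fin n → Bool) → Set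
  Config₃ S = ∃ λ v → ∃ λ z → ∃ λ w →
    IsTwo S v × nbr S v z ≡ true × nbr S z w ≡ true × w ≢ v × IsTwo S w
  Config₄ : (Fin n → Bool) → Set
  Config₄ S = ∃ λ v → ∃ λ z → ∃ λ w → ∃ λ x →
    IsTwo S v × nbr S v z ≡ true × nbr S z w ≡ true × w ≢ v × nbr S w x ≡ true × IsTwo S x

  config₁? : ∀ S → Dec (Config₁ S)
  config₁? S = any? λ u → (S u ≟ᵇ true) ×-dec (deg S u ≤? 1)

  config₂? : ∀ S → Dec (Config₂ S)
  config₂? S = any? λ v → any? λ z → isTwo? S v ×-dec (nbr S v z ≟ᵇ true) ×-dec (deg S z ≤? 2)

  config₃? : ∀ S → Dec (Config₃ S)
  config₃? S = any? λ v → any? λ z → any? λ w →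
    isTwo? S v ×-dec (nbr S v z ≟ᵇ true) ×-dec (nbr S z w ≟ᵇ true) ×-dec ¬? (w ≟ v) ×-dec isTwo? S w

  config₄? : ∀ S → Dec (Config₄ S)
  config₄? S = any? λ v → any? λ z → any? λ w → any? λ x →
    isTwo? S v ×-dec (nbr S v z ≟ᵇ true) ×-dec (nbr S z w ≟ᵇ true) ×-dec ¬? (w ≟ v) ×-dec
    (nbr S w x ≟ᵇ true) ×-dec isTwo? S x

  -- Each reducible configuration of G[S] allows a colouring of G[S ∖ v], for a suitable v,
  -- to be extended to G[S]: the vertices whose conflicts changed are recoloured, then v.
  module Reductions (S : Fin n → Bool) (IH : ∀ v → S v ≡ true → Colourable (S ∖ v)) where
    open Recolouring (conflict S) (conflict-sym S) (conflict-irrefl S)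

    S∖-⊆ : ∀ {v} → (S ∖ v) ⊆ S
    S∖-⊆ _ = ∖-⊆ {P = S}

    nbr-intro : ∀ {u a} → A a u ≡ true → (S ∖ u) a ≡ true → nbr S u a ≡ true
    nbr-intro {u} {a} au sa = ∧-intro (trans (symm G u a) au) (∖-⊆ {P = S} sa)

    -- removing u of degree ≤ 1 creates no conflicts, and u has at most 2 conflicts
    reduce₁ : Config₁ S → Colourable S
    reduce₁ (u , su , u≤1) with IH u su
    ... | c , proper = greedy (lift ⊆-refl proper apart)
                              (≤-trans (conflicts-≤2deg ⊆-refl su) (*-monoʳ-≤ 2 (m≤n⇒m≤1+n u≤1)))
      where
      apart : ∀ a b → (S ∖ u) a ≡ true → (S ∖ u) b ≡ true → a ≢ b → A a u ≡ true → A b u ≡ true → ⊥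
      apart a b sa sb a≢b au bu = contradiction u≤1 (<⇒≱ (count-≥2 (nbr S u) (nbr-intro au sa) (nbr-intro bu sb) a≢b))

    -- Removing v only creates the conflict between its two neighbours, so after
    -- recolouring z the colouring is proper on S ∖ v; then v has at most 4 conflicts.
    reduce-two : ∀ {v z} → IsTwo S v → nbr S v z ≡ true → Recolourable (conflict S) (S ∖ v) z → Colourable S
    reduce-two {v} {z} (sv , dv) vz rec with IH v sv
    ... | c , proper with recolour (lift (λ _ → ∖-⊆ {P = S ∖ v}) proper apart) rec
      where
      apart : ∀ a b → ((S ∖ v) ∖ z) a ≡ true → ((S ∖ v) ∖ z) b ≡ true → a ≢ b → A a v ≡ true → A b v ≡ true → ⊥
      apart a b sa sb a≢b av bv =
        contradiction (count-≥3 (nbr S v) vz (nbr-intro av (∖-⊆ {P = S ∖ v} sa)) (nbr-intro bv (∖-⊆ {P = S ∖ v} sb))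
                                (≢-sym (∖-≢ {P = S ∖ v} sa)) (≢-sym (∖-≢ {P = S ∖ v} sb)) a≢b)
                      (subst (λ d → ¬ 3 ≤ d) (sym dv) λ { (s≤s (s≤s ())) })
    ... | c′ , proper′ = greedy proper′ (≤-trans (conflicts-≤2deg ⊆-refl sv) (≤-reflexive (cong (2 *_) dv)))

    -- z has degree ≤ 2, hence at most 4 conflicts
    reduce₂ : Config₂ S → Colourable S
    reduce₂ (v , z , two-v , vz , z≤2) =
      reduce-two two-v vz (inj₁ (≤-trans (conflicts-≤2deg S∖-⊆ (nbr-∈ S vz)) (*-monoʳ-≤ 2 z≤2)))

    light-two : ∀ {v z} → IsTwo S v → nbr S v z ≡ true → light S (S ∖ v) z v ≡ true
    light-two (sv , dv) vz =
      light-intro {S} (nbr-flip S sv vz) (≤-pred (≤-trans (reach-bound S∖-⊆ vz) (≤-reflexive dv)))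

    -- z has the two light neighbours v and w, hence at most 4 conflicts
    reduce₃ : Config₃ S → Colourable S
    reduce₃ (v , z , w , two-v , vz , zw , w≢v , (sw , dw)) =
      reduce-two two-v vz (inj₁ (conflicts-two-light S∖-⊆ (nbr-∈ S vz) (light-two two-v vz) light-w (≢-sym w≢v)))
      where
      light-w : light S (S ∖ v) z w ≡ true
      light-w = light-intro {S} zw (≤-pred (≤-trans (reach-bound S∖-⊆ (nbr-flip S (nbr-∈ S vz) zw)) (≤-reflexive dw)))

    -- z has the light neighbour v, hence at most 5 conflicts, one of them the 2-vertex x
    -- with at most 4 conflicts; degenerate walks fall under the previous cases
    reduce₄ : Config₄ S → Colourable S
    reduce₄ (v , z , w , x , two-v , vz , zw , w≢v , wx , two-x) with x ≟ v
    -- the walk closes a triangle v z w: w is light too, as its neighbour v lies outside S ∖ v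
    ... | yes refl = reduce-two two-v vz (inj₁ (conflicts-two-light S∖-⊆ sz (light-two two-v vz) light-w (≢-sym w≢v)))
      where
      sz : S z ≡ true
      sz = nbr-∈ S vz
      light-w : light S (S ∖ v) z w ≡ true
      light-w = light-intro {S} zw (≤-pred (≤-pred (≤-trans w-reach (deg≤3 S w))))
        where
        w-reach : suc (suc (reach (S ∖ v) w z)) ≤ deg S w
        w-reach = reach-bound₂ S∖-⊆ (nbr-flip S sz zw) wx (adj-≢ (nbr-adj S vz)) (∖-self S v)
    ... | no x≢v with x ≟ z
    ...   | yes refl = reduce₂ (v , x , two-v , vz , ≤-reflexive (proj₂ two-x))
    ...   | no x≢z   = reduce-two two-v vz (inj₂ (conflicts-one-light S∖-⊆ sz (light-two two-v vz) , x , zx , x≤4))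
      where
      sz : S z ≡ true
      sz = nbr-∈ S vz
      sx : S x ≡ true
      sx = proj₁ two-x
      zx : conflicts (conflict S) (S ∖ v) z x ≡ true
      zx = ∧-intro (removed {P = S} sx x≢v)
                   (conflict-intro w (≢-sym x≢z) (nbr-∈ S zw) (nbr-adj S zw) (nbr-adj S (nbr-flip S (nbr-∈ S zw) wx)))
      x≤4 : count (conflicts (conflict S) (S ∖ v) x) ≤ 4
      x≤4 = ≤-trans (conflicts-≤2deg S∖-⊆ sx) (≤-reflexive (cong (2 *_) (proj₂ two-x)))

  degreeSum : (Fin n → Bool) → ℕ
  degreeSum S = ∑[ u < n ] (boolToℕ (S u) * deg S u)

  Lonely : (Fin n → Bool) → Fin n → Set
  Lonely S w = IsThree S w × (∀ t → nbr S w t ≡ true → ¬ IsTwo S t)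

  lonely? : ∀ S w → Dec (Lonely S w)
  lonely? S w = isThree? S w ×-dec all? (λ t → (nbr S w t ≟ᵇ true) →-dec ¬? (isTwo? S t))

  -- Every vertex u starts with charge 13·deg(u) − 36, i.e. −10 for a 2-vertex and 3 for
  -- a 3-vertex. A 3-vertex sends 3 to each adjacent 2-vertex, and a lonely 3-vertex w
  -- sends 1 along each path w z v to a 2-vertex v; afterwards all charges are nonnegative.
  module Discharging (S : Fin n → Bool)
                     (no₁ : ¬ Config₁ S) (no₂ : ¬ Config₂ S) (no₃ : ¬ Config₃ S) (no₄ : ¬ Config₄ S) where

    deg-2-or-3 : ∀ {u} → S u ≡ true → deg S u ≡ 2 ⊎ deg S u ≡ 3
    deg-2-or-3 {u} su = two-or-three (≰⇒> (λ u≤1 → no₁ (u , su , u≤1))) (deg≤3 S u)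

    nbr-of-two : ∀ {v z} → IsTwo S v → nbr S v z ≡ true → IsThree S z
    nbr-of-two {v} {z} two-v vz = nbr-∈ S vz , ≤-antisym (deg≤3 S z) (≰⇒> λ z≤2 → no₂ (v , z , two-v , vz , z≤2))

    two-nbrs-unique : ∀ {z a b} → S z ≡ true → nbr S z a ≡ true → IsTwo S a → nbr S z b ≡ true → IsTwo S b → a ≡ b
    two-nbrs-unique {z} {a} {b} sz za two-a zb two-b with a ≟ b
    ... | yes a≡b = a≡b
    ... | no  a≢b = ⊥-elim (no₃ (a , z , b , two-a , nbr-flip S sz za , zb , a≢b ∘ sym , two-b))

    far-is-lonely : ∀ {v z w} → IsTwo S v → nbr S v z ≡ true → nbr S z w ≡ true → w ≢ v → Lonely S w
    far-is-lonely {v} {z} {w} two-v vz zw w≢v =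
      (sw , three) , λ x wx two-x → no₄ (v , z , w , x , two-v , vz , zw , w≢v , wx , two-x)
      where
      sw : S w ≡ true
      sw = nbr-∈ S zw
      three : deg S w ≡ 3
      three with deg-2-or-3 sw
      ... | inj₁ dw = ⊥-elim (no₃ (v , z , w , two-v , vz , zw , w≢v , (sw , dw)))
      ... | inj₂ dw = dw

    Feeds : Fin n → Fin n → Set
    Feeds w v = IsThree S w × A w v ≡ true × IsTwo S v

    feeds? : ∀ w v → Dec (Feeds w v)
    feeds? w v = isThree? S w ×-dec (A w v ≟ᵇ true) ×-dec isTwo? S v

    Relays : Fin n → Fin n → Fin n → Set
    Relays w z v = Lonely S w × nbr S w z ≡ true × A z v ≡ true × IsTwo S v

    relays? : ∀ w z v → Dec (Relays w z v)
    relays? w z v = lonely? S w ×-dec (nbr S w z ≟ᵇ true) ×-dec (A z v ≟ᵇ true) ×-dec isTwo? S v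

    send : Fin n → Fin n → ℕ
    send w v = 3 * ⟦ feeds? w v ⟧ + ∑[ z < n ] ⟦ relays? w z v ⟧

    give receive : Fin n → ℕ
    give    w = ∑[ v < n ] send w v
    receive v = ∑[ w < n ] send w v

    -- a 2-vertex v receives 3 from each of its two neighbours z, which are 3-vertices,
    -- and 1 from each of the two other neighbours w of each z, which are lonely
    receive-two : ∀ {v} → IsTwo S v → 10 ≤ receive v
    receive-two {v} two-v@(sv , dv) = begin
      10                                     ≡⟨ cong (λ d → 3 * d + 2 * d) (sym dv) ⟩
      3 * deg S v + 2 * deg S v              ≤⟨ +-mono-≤ (*-monoʳ-≤ 3 fed) relayed ⟩
      3 * ∑[ w < n ] ⟦ feeds? w v ⟧ + ∑[ z < n ] ∑[ w < n ] ⟦ relays? w z v ⟧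
        ≡⟨ cong₂ _+_ (*-distribˡ-sum {n} 3 (λ w → ⟦ feeds? w v ⟧)) (∑-comm (λ z w → ⟦ relays? w z v ⟧)) ⟩
      ∑[ w < n ] (3 * ⟦ feeds? w v ⟧) + ∑[ w < n ] ∑[ z < n ] ⟦ relays? w z v ⟧
        ≡⟨ sym (∑-distrib-+ (λ w → 3 * ⟦ feeds? w v ⟧) (λ w → ∑[ z < n ] ⟦ relays? w z v ⟧)) ⟩
      receive v ∎
      where
      open ≤-Reasoning
      fed : deg S v ≤ ∑[ w < n ] ⟦ feeds? w v ⟧
      fed = count-mono λ w vw → dec-true (feeds? w v) (nbr-of-two two-v vw , nbr-adj S (nbr-flip S sv vw) , two-v)
      through : ∀ z → 2 * boolToℕ (nbr S v z) ≤ ∑[ w < n ] ⟦ relays? w z v ⟧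
      through z with nbr S v z in vz
      ... | false = z≤n
      ... | true  = begin
        2                   ≡⟨ +-cancelˡ-≡ 1 2 _ (trans (sym (proj₂ (nbr-of-two two-v vz)))
                                                        (trans (count-remove (nbr S z) v)
                                                               (cong (λ b → boolToℕ b + count (nbr S z ∖ v)) (nbr-flip S sv vz)))) ⟩
        count (nbr S z ∖ v) ≤⟨ count-mono relay ⟩
        ∑[ w < n ] ⟦ relays? w z v ⟧ ∎
        where
        relay : (nbr S z ∖ v) ⊆ (λ w → does (relays? w z v))
        relay w zw = dec-true (relays? w z v)
          ( far-is-lonely two-v vz (∖-⊆ {P = nbr S z} zw) (∖-≢ {P = nbr S z} zw)
          , nbr-flip S (nbr-∈ S vz) (∖-⊆ {P = nbr S z} zw)
          , nbr-adj S (nbr-flip S sv vz)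
          , two-v )
      relayed : 2 * deg S v ≤ ∑[ z < n ] ∑[ w < n ] ⟦ relays? w z v ⟧
      relayed = ≤-trans (≤-reflexive (*-distribˡ-sum {n} 2 (boolToℕ ∘ nbr S v))) (∑-mono through)

    fed-by relayed-by : Fin n → ℕ
    fed-by     w = ∑[ v < n ] ⟦ feeds? w v ⟧
    relayed-by w = ∑[ v < n ] ∑[ z < n ] ⟦ relays? w z v ⟧

    give-split : ∀ w → give w ≡ 3 * fed-by w + relayed-by w
    give-split w = trans (∑-distrib-+ (λ v → 3 * ⟦ feeds? w v ⟧) (λ v → ∑[ z < n ] ⟦ relays? w z v ⟧))
                         (cong (_+ relayed-by w) (sym (*-distribˡ-sum {n} 3 (λ v → ⟦ feeds? w v ⟧))))

    fed-by≤three : ∀ w → fed-by w ≤ ⟦ isThree? S w ⟧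
    fed-by≤three w = count≤indicator (λ v → does (feeds? w v))
                       (λ v f → dec-true (isThree? S w) (proj₁ (fromDoes (feeds? w v) f))) unique
      where
      unique : ∀ a b → does (feeds? w a) ≡ true → does (feeds? w b) ≡ true → a ≡ b
      unique a b fa fb with fromDoes (feeds? w a) fa | fromDoes (feeds? w b) fb
      ... | (sw , _) , wa , two-a | _ , wb , two-b =
        two-nbrs-unique sw (∧-intro wa (proj₁ two-a)) two-a (∧-intro wb (proj₁ two-b)) two-b

    fed-by-lonely : ∀ {w} → Lonely S w → fed-by w ≡ 0
    fed-by-lonely {w} (_ , no-two) =
      count-empty λ v → dec-false (feeds? w v) λ (_ , wv , two-v) → no-two v (∧-intro wv (proj₁ two-v)) two-v

    -- a lonely vertex relays along at most one path through each of its neighbours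
    relayed-by≤3 : ∀ w → relayed-by w ≤ 3
    relayed-by≤3 w = begin
      relayed-by w                          ≡⟨ ∑-comm (λ v z → ⟦ relays? w z v ⟧) ⟩
      ∑[ z < n ] ∑[ v < n ] ⟦ relays? w z v ⟧ ≤⟨ ∑-mono perNeighbour ⟩
      deg S w                               ≤⟨ deg≤3 S w ⟩
      3 ∎
      where
      open ≤-Reasoning
      perNeighbour : ∀ z → ∑[ v < n ] ⟦ relays? w z v ⟧ ≤ boolToℕ (nbr S w z)
      perNeighbour z = count≤indicator (λ v → does (relays? w z v))
                                       (λ v → proj₁ ∘ proj₂ ∘ fromDoes (relays? w z v)) unique
        where
        unique : ∀ a b → does (relays? w z a) ≡ true → does (relays? w z b) ≡ true → a ≡ b
        unique a b ra rb with fromDoes (relays? w z a) ra | fromDoes (relays? w z b) rb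
        ... | _ , wz , za , two-a | _ , _ , zb , two-b =
          two-nbrs-unique (nbr-∈ S wz) (∧-intro za (proj₁ two-a)) two-a (∧-intro zb (proj₁ two-b)) two-b

    relayed-by-not-lonely : ∀ {w} → ¬ Lonely S w → relayed-by w ≡ 0
    relayed-by-not-lonely {w} not-lonely =
      trans (sum-cong-≗ λ v → count-empty λ z → dec-false (relays? w z v) (not-lonely ∘ proj₁))
            (sum-replicate-zero n)

    give-bound : ∀ w → give w ≤ 3 * ⟦ isThree? S w ⟧
    give-bound w = subst (_≤ 3 * ⟦ isThree? S w ⟧) (sym (give-split w)) (by-lonely (lonely? S w))
      where
      open ≤-Reasoning
      by-lonely : Dec (Lonely S w) → 3 * fed-by w + relayed-by w ≤ 3 * ⟦ isThree? S w ⟧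
      by-lonely (yes lonely) = begin
        3 * fed-by w + relayed-by w  ≡⟨ cong (λ f → 3 * f + relayed-by w) (fed-by-lonely lonely) ⟩
        relayed-by w                 ≤⟨ relayed-by≤3 w ⟩
        3                            ≡⟨ sym (cong (3 *_) (⟦⟧-yes (isThree? S w) (proj₁ lonely))) ⟩
        3 * ⟦ isThree? S w ⟧         ∎
      by-lonely (no not-lonely) = begin
        3 * fed-by w + relayed-by w  ≡⟨ cong (3 * fed-by w +_) (relayed-by-not-lonely not-lonely) ⟩
        3 * fed-by w + 0             ≡⟨ +-identityʳ _ ⟩
        3 * fed-by w                 ≤⟨ *-monoʳ-≤ 3 (fed-by≤three w) ⟩
        3 * ⟦ isThree? S w ⟧         ∎

    give-three : ∀ {w} → IsThree S w → give w ≤ 3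
    give-three {w} three = ≤-trans (give-bound w) (≤-reflexive (cong (3 *_) (⟦⟧-yes (isThree? S w) three)))

    give-other : ∀ {w} → ¬ IsThree S w → give w ≤ 0
    give-other {w} other = ≤-trans (give-bound w) (≤-reflexive (cong (3 *_) (⟦⟧-no (isThree? S w) other)))

    final-charge : ∀ u → 36 * boolToℕ (S u) + give u ≤ 13 * (boolToℕ (S u) * deg S u) + receive u
    final-charge u = by-membership (S u) refl
      where
      by-membership : ∀ b → S u ≡ b → 36 * boolToℕ b + give u ≤ 13 * (boolToℕ b * deg S u) + receive u
      by-membership false su = ≤-trans (give-other outside) z≤n
        where
        outside : ¬ IsThree S u
        outside (su′ , _) = true≢false (trans (sym su′) su)
      by-membership true su with deg-2-or-3 su
      ... | inj₁ d2 = begin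
        36 + give u                       ≤⟨ +-monoʳ-≤ 36 (give-other not-three) ⟩
        26 + 10                           ≤⟨ +-monoʳ-≤ 26 (receive-two (su , d2)) ⟩
        26 + receive u                    ≡⟨ cong (λ d → 13 * (1 * d) + receive u) (sym d2) ⟩
        13 * (1 * deg S u) + receive u    ∎
        where
        open ≤-Reasoning
        not-three : ¬ IsThree S u
        not-three (_ , d3) = contradiction (trans (sym d2) d3) λ ()
      ... | inj₂ d3 = begin
        36 + give u                       ≤⟨ +-monoʳ-≤ 36 (give-three (su , d3)) ⟩
        39                                ≤⟨ m≤m+n 39 (receive u) ⟩
        39 + receive u                    ≡⟨ cong (λ d → 13 * (1 * d) + receive u) (sym d3) ⟩
        13 * (1 * deg S u) + receive u    ∎
        where open ≤-Reasoning

    -- the charge is conserved, so the total initial charge 13·∑ deg − 36·|S| is nonnegative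
    average-degree : 36 * count S ≤ 13 * degreeSum S
    average-degree = +-cancelʳ-≤ (∑[ u < n ] give u) _ _ (begin
      36 * count S + ∑[ u < n ] give u
        ≡⟨ cong (_+ ∑[ u < n ] give u) (*-distribˡ-sum {n} 36 (boolToℕ ∘ S)) ⟩
      ∑[ u < n ] (36 * boolToℕ (S u)) + ∑[ u < n ] give u
        ≡⟨ sym (∑-distrib-+ (λ u → 36 * boolToℕ (S u)) give) ⟩
      ∑[ u < n ] (36 * boolToℕ (S u) + give u)
        ≤⟨ ∑-mono final-charge ⟩
      ∑[ u < n ] (13 * (boolToℕ (S u) * deg S u) + receive u)
        ≡⟨ ∑-distrib-+ (λ u → 13 * (boolToℕ (S u) * deg S u)) receive ⟩
      ∑[ u < n ] (13 * (boolToℕ (S u) * deg S u)) + ∑[ u < n ] receive u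
        ≡⟨ cong₂ _+_ (sym (*-distribˡ-sum {n} 13 (λ u → boolToℕ (S u) * deg S u))) (sym (∑-comm send)) ⟩
      13 * degreeSum S + ∑[ u < n ] give u ∎)
      where open ≤-Reasoning

  ∈-tabulate : ∀ {S : Fin n → Bool} {u} → S u ≡ true → u ∈ tabulate S
  ∈-tabulate {S} {u} su = lookup⇒[]= u (tabulate S) (trans (lookup∘tabulate S u) su)

  induced : (Fin n → Bool) → Subgraph G
  induced S = record
    { verts    = tabulate S
    ; edges    = λ u w → S u ∧ nbr S u w
    ; esymm    = λ u w → trans (cong (λ a → S u ∧ (a ∧ S w)) (symm G u w)) (swap (S u) (S w) (A w u))
    ; eInG     = λ u w e → nbr-adj S (proj₂ (∧-elim (S u) e))
    ; eInVerts = λ u w e → ∈-tabulate {S} (proj₁ (∧-elim (S u) e)) ,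
                           ∈-tabulate {S} (nbr-∈ S (proj₂ (∧-elim (S u) e)))
    }
    where
    swap : ∀ a b c → a ∧ (c ∧ b) ≡ b ∧ (c ∧ a)
    swap true  true  c = refl
    swap true  false c = ∧-zeroʳ c
    swap false true  c = sym (∧-zeroʳ c)
    swap false false c = refl

  degreeSum≡2|E| : ∀ S → 2 * edgeCount (induced S) ≡ degreeSum S
  degreeSum≡2|E| S = begin
    2 * edgeCount (induced S)
      ≡⟨ cong (2 *_) (trans (sum-map-tabulate (λ u → countTrue (λ w → (toℕ u <ᵇ toℕ w) ∧ e u w)) id)
                            (sum-cong-≗ (λ u → countTrue≡count (λ w → (toℕ u <ᵇ toℕ w) ∧ e u w)))) ⟩
    2 * ∑[ u < n ] count (λ w → (toℕ u <ᵇ toℕ w) ∧ e u w)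
      ≡⟨ handshake e (esymm (induced S)) e-irrefl ⟩
    ∑[ u < n ] count (e u)
      ≡⟨ sum-cong-≗ degree-at ⟩
    degreeSum S ∎
    where
    open ≡-Reasoning
    e : Fin n → Fin n → Bool
    e = edges (induced S)
    e-irrefl : ∀ u → e u u ≡ false
    e-irrefl u rewrite irrefl G u = ∧-zeroʳ (S u)
    degree-at : ∀ u → count (e u) ≡ boolToℕ (S u) * deg S u
    degree-at u with S u
    ... | true  = sym (+-identityʳ (deg S u))
    ... | false = count-empty {n} (λ _ → refl)

  sparse : MadLessThan G 36 13 → ∀ S {u} → S u ≡ true → 13 * degreeSum S < 36 * count S
  sparse mad S {u} su = subst₂ (λ e v → 13 * e < 36 * v) (degreeSum≡2|E| S) (tabulate-size S)
                               (mad (induced S) (u , ∈-tabulate {S} su))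

  -- the induction step: a nonempty G[S] contains a reducible configuration, since a
  -- configuration-free one would violate the sparsity hypothesis
  step : MadLessThan G 36 13 → ∀ S → (∀ v → S v ≡ true → Colourable (S ∖ v)) →
         ∀ {u} → S u ≡ true → Colourable S
  step mad S IH su with config₁? S | config₂? S | config₃? S | config₄? S
  ... | yes c | _     | _     | _     = Reductions.reduce₁ S IH c
  ... | no _  | yes c | _     | _     = Reductions.reduce₂ S IH c
  ... | no _  | no _  | yes c | _     = Reductions.reduce₃ S IH c
  ... | no _  | no _  | no _  | yes c = Reductions.reduce₄ S IH c
  ... | no no₁ | no no₂ | no no₃ | no no₄ =
    contradiction (Discharging.average-degree S no₁ no₂ no₃ no₄) (<⇒≱ (sparse mad S su))

  colourable : MadLessThan G 36 13 → ∀ k S → count S ≡ k → Colourable S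
  colourable mad zero S empty = (λ _ → zero) , λ u _ su → contradiction (subst (1 ≤_) empty (count-pos S su)) λ ()
  colourable mad (suc k) S size with any? (λ u → S u ≟ᵇ true)
  ... | yes (u , su) = step mad S (λ v sv → colourable mad k (S ∖ v) (smaller v sv)) su
    where
    smaller : ∀ v → S v ≡ true → count (S ∖ v) ≡ k
    smaller v sv = suc-injective (trans (sym (subst (λ b → count S ≡ boolToℕ b + count (S ∖ v)) sv (count-remove S v)))
                                        size)
  ... | no none = contradiction (trans (sym size) (count-empty (λ u → ¬-not λ su → none (u , su)))) λ ()

theorem2 : (n : ℕ) (G : Graph n) → MaxDegreeIs G 3 → MadLessThan G 36 13 →
    InjChromaticAtMost G 5
theorem2 n G (Δ≤3 , _) mad = colouring , injective
  where
  open InducedSubgraphs G Δ≤3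
  everything : Fin n → Bool
  everything _ = true
  G-colourable : Colourable everything
  G-colourable = colourable mad (count everything) everything refl
  colouring : Fin n → Fin 5
  colouring = proj₁ G-colourable
  injective : IsInjectiveColoring G colouring
  injective u v w u≢v uw vw = proj₂ G-colourable u v refl refl (conflict-intro w u≢v refl uw vw)
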